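{- Fix integers $u_1 \ge 1$ and $b \ge 1$, and for each $m \ge 1$ let $\mathbf{u}^{(m)} = (u_1, u_2, \ldots, u_m)$ with $u_i = u_1 + (i-1)b$. For $c \ge 1$ let $\widetilde{a_m}(c) = \dim_k\left(R_m / I_{W_m}(\mathbf{u}^{(m)})^{[\mathbf{u_m+c-1}]}\right)$. Then for $n \ge 3$ and $c \ge 1$, $$\widetilde{a_n}(c) = (n-1)b\, \widetilde{a_{n-1}}(c) + c\, \widetilde{a_{n-1}}(c+b).$$
   Context: $k$ is a field, $R_m = k[x_1,\ldots,x_m]$, $\mathfrak{S}_m$ the permutations of $[m]$ in one-line notation; $\sigma$ avoids a pattern $\tau$ if no subsequence of $\sigma(1)\cdots\sigma(m)$ has the same relative order as $\tau$. $W_m = \mathfrak{S}_m(132,312)$ (permutations avoiding $132$ and $312$). For $\mathbf{u}=(u_1,\ldots,u_m)$ with $1\le u_1<\cdots<u_m$, $I_{W_m}(\mathbf{u}) = \langle \prod_{i=1}^m x_i^{u_{\sigma(i)}} : \sigma\in W_m\rangle \subseteq R_m$. For $\mathbf{a}\in\mathbb{N}^m$ and a monomial ideal $I$ whose minimal generators divide $\mathbf{x}^{\mathbf{a}}$, the Alexander dual is $I^{[\mathbf{a}]} = \bigcap_{\mathbf{x}^{\mathbf{b}}} \mathfrak{m}^{\mathbf{a}\setminus\mathbf{b}}$ over minimal generators $\mathbf{x}^{\mathbf{b}}$ of $I$, with $(\mathbf{a}\setminus\mathbf{b})_i = a_i+1-b_i$ if $b_i\ge1$, $0$ if $b_i=0$,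 and $\mathfrak{m}^{\mathbf{d}} = \langle x_i^{d_i} : d_i\ge1\rangle$. $\mathbf{u_m+c-1}$ denotes $(u_m+c-1,\ldots,u_m+c-1)\in\mathbb{N}^m$. -}

module Defs where

open import Data.Nat using (ℕ; zero; suc; _+_; _*_; _∸_; _≤_; _<_)
open import Data.Fin using (Fin; toℕ; fromℕ)
import Data.Fin as F
open import Data.Vec using (Vec; lookup; tabulate; replicate)
open import Data.Product using (Σ; ∃; _×_; _,_)
open import Data.List using (List; length)
open import Data.List.Relation.Unary.Unique.Propositional using (Unique)
open import Data.List.Membership.Propositional using (_∈_)
open import Function.Bundles using (_⇔_)
open import Function.Definitions using (Injective)
open import Relation.Binary.PropositionalEquality using (_≡_)
open import Relation.Nullary using (¬_)

Perm : ℕ → Set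
Perm m = Σ (Fin m → Fin m) (Injective _≡_ _≡_)

Contains : ∀ {m p} → (Fin m → Fin m) → (Fin p → Fin p) → Set
Contains {m} {p} σ τ =
  Σ (Fin p → Fin m) λ f →
    (∀ x y → x F.< y → f x F.< f y) ×
    (∀ x y → (τ x F.< τ y) ⇔ (σ (f x) F.< σ (f y)))

Avoids : ∀ {m p} → (Fin m → Fin m) → (Fin p → Fin p) → Set
Avoids σ τ = ¬ Contains σ τ

-- one-line patterns 132 and 312 (0-indexed values)
pat132 : Fin 3 → Fin 3
pat132 F.zero = F.zero
pat132 (F.suc F.zero) = F.suc (F.suc F.zero)
pat132 (F.suc (F.suc F.zero)) = F.suc F.zero

pat312 : Fin 3 → Fin 3
pat312 F.zero = F.suc (F.suc F.zero)
pat312 (F.suc F.zero) = F.zero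
pat312 (F.suc (F.suc F.zero)) = F.suc F.zero

InW : (m : ℕ) → Perm m → Set
InW m (σ , _) = Avoids σ pat132 × Avoids σ pat312

Mono : ℕ → Set
Mono m = Vec ℕ m

_∣ᵐ_ : ∀ {m} → Mono m → Mono m → Set
g ∣ᵐ e = ∀ i → lookup g i ≤ lookup e i

Gens : ℕ → Set₁
Gens m = Mono m → Set

InIdeal : ∀ {m} → Gens m → Mono m → Set
InIdeal {m} G e = Σ (Mono m) λ g → G g × g ∣ᵐ e

MinGen : ∀ {m} → Gens m → Mono m → Set
MinGen {m} G b = G b × (∀ (g : Mono m) → G g → g ∣ᵐ b → g ≡ b)

diffExp : ∀ {m} → Mono m → Mono m → Mono m
diffExp a b = tabulate λ i → step (lookup a i) (lookup b i)
  where
  step : ℕ → ℕ → ℕ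
  step ai zero    = zero
  step ai (suc n) = ai + 1 ∸ suc n

-- x^e ∈ 𝔪^d = ⟨ x_i^{d_i} : d_i ≥ 1 ⟩
InMPow : ∀ {m} → Mono m → Mono m → Set
InMPow {m} d e = Σ (Fin m) λ i → 1 ≤ lookup d i × lookup d i ≤ lookup e i

-- x^e ∈ I^[a] = ⋂_{x^b minimal generator of I} 𝔪^{a ∖ b}
InAlexDual : ∀ {m} → Mono m → Gens m → Mono m → Set
InAlexDual a G e = ∀ b → MinGen G b → InMPow (diffExp a b) e

-- dim_k (R_m / J) = d for a monomial ideal J (membership predicate on
-- monomials): the monomials not in J form a k-basis of R_m / J, so the
-- dimension is the number of such standard monomials.
DimQuotient : (m : ℕ) → (Mono m → Set) → ℕ → Set
DimQuotient m inJ d =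
  Σ (List (Mono m)) λ L →
    Unique L × (∀ e → (e ∈ L) ⇔ (¬ inJ e)) × length L ≡ d

GenW : (m : ℕ) → (Fin m → ℕ) → Gens m
GenW m u b = Σ (Perm m) λ σ → InW m σ × b ≡ tabulate (λ i → u (Σ.proj₁ σ i))
  where open Data.Product

-- u^{(m)}_i = u_1 + (i-1) b  (i 0-indexed here)
uVec : (u1 b m : ℕ) → Fin m → ℕ
uVec u1 b m i = u1 + toℕ i * b

uLast : (u1 b m : ℕ) → ℕ
uLast u1 b m = u1 + (m ∸ 1) * b

ATilde : (u1 b m c d : ℕ) → Set
ATilde u1 b m c d =
  DimQuotient m
    (InAlexDual (replicate m (uLast u1 b m + c ∸ 1)) (GenW m (uVec u1 b m)))
    d

{-# OPTIONS --safe #-}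
module Submission where

-- A permutation avoids 132 and 312 iff each of its entries is larger or smaller than all
-- entries before it, so the elements of W_n are those of W_{n-1} with a new maximum or a new
-- minimum appended.  The generators x^{u_σ} (σ ∈ W_n) are all minimal, and, writing c = K + 1
-- and σ with values 0 … n-1, a monomial x^e lies outside the Alexander dual iff e lies in the
-- box  σ(i) b + e_i ≤ (n-1) b + K  of some σ ∈ W_n.  If σ ends with its maximum, the box
-- forces e_n ≤ K and leaves a box of level K + b for the first n - 1 exponents; if σ ends with
-- its minimum, it forces e_n ≤ (n-1) b + K and keeps the level K.  Level-K boxes lie inside
-- level-(K+b) ones, so the standard monomials are: e_n ≤ K with the rest standard at level
-- K + b (c · ã_{n-1}(c+b) of them), or K < e_n ≤ (n-1) b + K with the rest standard at level K
-- ((n-1) b · ã_{n-1}(c) of them).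

open import Data.Empty using (⊥; ⊥-elim)
open import Data.Fin as F using (Fin; zero; suc; toℕ; fromℕ; inject₁; punchIn; punchOut)
open import Data.Fin.Patterns using (0F; 1F; 2F)
import Data.Fin.Properties as FP
open import Data.Fin.Relation.Unary.Top using (view; ‵fromℕ; ‵inject₁)
open import Data.List as List using (List; []; _∷_; length; _++_; upTo; applyUpTo; cartesianProductWith)
open import Data.List.Membership.Propositional using (_∈_)
open import Data.List.Membership.Propositional.Properties
  using (++-∈⇔; ∈-cartesianProductWith⁺; ∈-cartesianProductWith⁻; ∈-upTo⁺; ∈-upTo⁻;
         ∈-applyUpTo⁺; ∈-applyUpTo⁻)
open import Data.List.Membership.Propositional.Properties.WithK using (unique∧set⇒bag)
open import Data.List.Properties using (length-++; length-map; length-upTo; length-applyUpTo)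
open import Data.List.Relation.Binary.BagAndSetEquality using (∼bag⇒↭)
open import Data.List.Relation.Binary.Permutation.Propositional.Properties using (↭-length)
open import Data.List.Relation.Unary.Unique.Propositional using (Unique)
import Data.List.Relation.Unary.Unique.Propositional.Properties as Unique
open import Data.Nat
  using (ℕ; zero; suc; _+_; _*_; _∸_; _≤_; _<_; z≤n; s≤s; s≤s⁻¹; z<s; s<s; _≤?_; NonZero; >-nonZero)
open import Data.Nat.Induction using (<-rec)
open import Data.Nat.Properties
open import Data.Nat.Tactic.RingSolver using (solve-∀)
open import Data.Product using (∃; ∃₂; _×_; _,_)
import Data.Product as Product
open import Data.Sum using (_⊎_; inj₁; inj₂)
import Data.Sum as Sum
open import Data.Sum.Function.Propositional using (_⊎-⇔_)
open import Data.Vec using (Vec; []; _∷_; lookup; tabulate; replicate; _∷ʳ_; initLast)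
open import Data.Vec.Properties using (lookup∘tabulate; lookup-replicate; tabulate-cong; ∷ʳ-injective; ∷ʳ-injectiveʳ)
open import Function using (_∘_; id; flip)
open import Function.Bundles using (_⇔_; mk⇔; Equivalence)
open import Function.Definitions using (Injective)
open import Function.Properties.Equivalence using () renaming (refl to ⇔-refl; trans to ⇔-trans; sym to ⇔-sym)
open import Relation.Binary using (_Preserves_⟶_; tri<; tri≈; tri>)
open import Relation.Binary.PropositionalEquality
open import Relation.Nullary using (¬_; Dec; yes; no; contradiction)
open import Relation.Nullary.Decidable using (_×-dec_; _⊎-dec_)

open import Defs

open Equivalence using (to; from)

-- Permutations avoiding 132 and 312

Between : ∀ {n} → Fin n → Fin n → Fin n → Set
Between x y z = (x F.< z × z F.< y) ⊎ (y F.< z × z F.< x)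

AllRecords : ∀ {n} → (Fin n → Fin n) → Set
AllRecords σ = ∀ {i j k} → i F.< j → j F.< k → ¬ Between (σ i) (σ j) (σ k)

allRecords-Fin1 : {σ : Fin 1 → Fin 1} → AllRecords σ
allRecords-Fin1 {i = 0F} {0F} ()

StrictlyIncreasing : ∀ {m n} → (Fin m → Fin n) → Set
StrictlyIncreasing f = f Preserves F._<_ ⟶ F._<_

increasing₃ : ∀ {n} {h : Fin 3 → Fin n} → h 0F F.< h 1F → h 1F F.< h 2F → StrictlyIncreasing h
increasing₃ h₀<h₁ h₁<h₂ {0F} {1F} _ = h₀<h₁
increasing₃ h₀<h₁ h₁<h₂ {0F} {2F} _ = FP.<-trans h₀<h₁ h₁<h₂
increasing₃ h₀<h₁ h₁<h₂ {1F} {2F} _ = h₁<h₂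
increasing₃ h₀<h₁ h₁<h₂ {_}  {0F} ()
increasing₃ h₀<h₁ h₁<h₂ {1F} {1F} (s≤s ())
increasing₃ h₀<h₁ h₁<h₂ {2F} {1F} (s≤s ())
increasing₃ h₀<h₁ h₁<h₂ {2F} {2F} (s≤s (s≤s ()))

increasing⇒reflects-< : ∀ {m n} {h : Fin m → Fin n} → StrictlyIncreasing h →
                        ∀ {x y} → h x F.< h y → x F.< y
increasing⇒reflects-< h↑ {x} {y} hx<hy with FP.<-cmp x y
... | tri< x<y _ _  = x<y
... | tri≈ _ refl _ = contradiction hx<hy (FP.<-irrefl refl)
... | tri> _ _ y<x  = contradiction (h↑ y<x) (FP.<-asym hx<hy)

Between-map : ∀ {m n} {f : Fin m → Fin n} → StrictlyIncreasing f →
              ∀ {x y z} → Between x y z → Between (f x) (f y) (f z)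
Between-map f↑ = Sum.map (Product.map f↑ f↑) (Product.map f↑ f↑)

Between-unmap : ∀ {m n} {f : Fin m → Fin n} → StrictlyIncreasing f →
                ∀ {x y z} → Between (f x) (f y) (f z) → Between x y z
Between-unmap f↑ = Sum.map (Product.map reflect reflect) (Product.map reflect reflect)
  where reflect = increasing⇒reflects-< f↑

contains⁺ : ∀ {m} {σ : Fin m → Fin m} (τ : Fin 3 → Fin 3) (f h : Fin 3 → Fin m) →
            StrictlyIncreasing f → StrictlyIncreasing h → (∀ x → h (τ x) ≡ σ (f x)) → Contains σ τ
contains⁺ τ f h f↑ h↑ h∘τ≡σ∘f = f , (λ _ _ → f↑) , λ x y → mk⇔
  (λ τx<τy → subst₂ F._<_ (h∘τ≡σ∘f x) (h∘τ≡σ∘f y) (h↑ τx<τy))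
  (λ σfx<σfy → increasing⇒reflects-< h↑
                 (subst₂ F._<_ (sym (h∘τ≡σ∘f x)) (sym (h∘τ≡σ∘f y)) σfx<σfy))

avoids⇒allRecords : ∀ {m} {σ : Fin m → Fin m} → Avoids σ pat132 → Avoids σ pat312 → AllRecords σ
avoids⇒allRecords {σ = σ} ¬132 ¬312 {i} {j} {k} i<j j<k (inj₁ (σi<σk , σk<σj)) =
  ¬132 (contains⁺ pat132 (lookup (i ∷ j ∷ k ∷ [])) (lookup (σ i ∷ σ k ∷ σ j ∷ []))
          (increasing₃ i<j j<k) (increasing₃ σi<σk σk<σj) λ { 0F → refl ; 1F → refl ; 2F → refl })
avoids⇒allRecords {σ = σ} ¬132 ¬312 {i} {j} {k} i<j j<k (inj₂ (σj<σk , σk<σi)) =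
  ¬312 (contains⁺ pat312 (lookup (i ∷ j ∷ k ∷ [])) (lookup (σ j ∷ σ k ∷ σ i ∷ []))
          (increasing₃ i<j j<k) (increasing₃ σj<σk σk<σi) λ { 0F → refl ; 1F → refl ; 2F → refl })

allRecords⇒avoids : ∀ {m} {σ : Fin m → Fin m} → AllRecords σ → Avoids σ pat132 × Avoids σ pat312
allRecords⇒avoids records =
  (λ (f , f↑ , iso) → records (f↑ 0F 1F z<s) (f↑ 1F 2F (s<s z<s))
                        (inj₁ (to (iso 0F 2F) z<s , to (iso 2F 1F) (s<s z<s)))) ,
  (λ (f , f↑ , iso) → records (f↑ 0F 1F z<s) (f↑ 1F 2F (s<s z<s))
                        (inj₂ (to (iso 1F 2F) z<s , to (iso 2F 0F) (s<s z<s))))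

injective⇒surjective : ∀ {n} {σ : Fin n → Fin n} → Injective _≡_ _≡_ σ → ∀ y → ∃ λ i → σ i ≡ y
injective⇒surjective {suc n} {σ} σ-inj y with FP.any? (λ i → σ i FP.≟ y)
... | yes hit = hit
... | no miss = contradiction (FP.injective⇒≤ {f = σ̂} σ̂-inj) 1+n≰n
  where
  y≢σ : ∀ i → y ≢ σ i
  y≢σ i y≡σi = miss (i , sym y≡σi)
  σ̂ : Fin (suc n) → Fin n
  σ̂ i = punchOut (y≢σ i)
  σ̂-inj : Injective _≡_ _≡_ σ̂
  σ̂-inj σ̂i≡σ̂j = σ-inj (FP.punchOut-injective (y≢σ _) (y≢σ _) σ̂i≡σ̂j)

-- If τ i < σ i, then by induction on σ's values the position where σ takes the value τ i is
-- also one where τ does, so it is i.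
injective-≤⇒≡ : ∀ {n} {σ τ : Fin n → Fin n} → Injective _≡_ _≡_ σ → Injective _≡_ _≡_ τ →
                (∀ i → τ i F.≤ σ i) → ∀ i → τ i ≡ σ i
injective-≤⇒≡ {σ = σ} {τ} σ-inj τ-inj τ≤σ i = <-rec P step (toℕ (σ i)) i refl
  where
  P : ℕ → Set
  P k = ∀ i → toℕ (σ i) ≡ k → τ i ≡ σ i
  step : ∀ k → (∀ {k′} → k′ < k → P k′) → P k
  step _ rec i refl with τ i FP.≟ σ i
  ... | yes τi≡σi = τi≡σi
  ... | no τi≢σi with injective⇒surjective σ-inj (τ i)
  ...   | i′ , σi′≡τi = contradiction (trans (sym σi′≡τi) (cong σ i′≡i)) τi≢σi
    where
    σi′<σi : σ i′ F.< σ i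
    σi′<σi = subst (F._< σ i) (sym σi′≡τi) (FP.≤∧≢⇒< (τ≤σ i) τi≢σi)
    i′≡i : i′ ≡ i
    i′≡i = τ-inj (trans (rec σi′<σi i′ refl) σi′≡τi)

Extreme : ∀ {n} → Fin (suc n) → Set
Extreme {n} x = x ≡ zero ⊎ x ≡ fromℕ n

extreme⇒¬Between : ∀ {n} {x y z : Fin (suc n)} → Extreme z → ¬ Between x y z
extreme⇒¬Between (inj₁ refl) (inj₁ (() , _))
extreme⇒¬Between (inj₁ refl) (inj₂ (() , _))
extreme⇒¬Between (inj₂ refl) (inj₁ (_ , z<y)) = <⇒≱ z<y (FP.≤fromℕ _)
extreme⇒¬Between (inj₂ refl) (inj₂ (_ , z<x)) = <⇒≱ z<x (FP.≤fromℕ _)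

-- Otherwise the last value lies strictly between the values 0 and n, taken at earlier positions.
last-extreme : ∀ {n} {σ : Fin (suc n) → Fin (suc n)} → Injective _≡_ _≡_ σ → AllRecords σ →
               Extreme (σ (fromℕ n))
last-extreme {n} {σ} σ-inj records with σ (fromℕ n) FP.≟ zero | σ (fromℕ n) FP.≟ fromℕ n
... | yes σL≡0 | _          = inj₁ σL≡0
... | no _     | yes σL≡max = inj₂ σL≡max
... | no σL≢0  | no σL≢max with injective⇒surjective σ-inj zero | injective⇒surjective σ-inj (fromℕ n)
...   | p , σp≡0 | q , σq≡max = ⊥-elim (no-middle p q
          (subst (F._< σ (fromℕ n)) (sym σp≡0) (FP.≤∧≢⇒< z≤n (σL≢0 ∘ sym)))
          (subst (σ (fromℕ n) F.<_) (sym σq≡max) (FP.≤∧≢⇒< (FP.≤fromℕ _) σL≢max)))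
  where
  before-last : ∀ {p} → σ p ≢ σ (fromℕ n) → p F.< fromℕ n
  before-last σp≢σL = FP.≤∧≢⇒< (FP.≤fromℕ _) (σp≢σL ∘ cong σ)
  no-middle : ∀ p q → σ p F.< σ (fromℕ n) → σ (fromℕ n) F.< σ q → ⊥
  no-middle p q σp<σL σL<σq with FP.<-cmp p q
  ... | tri< p<q _ _  = records p<q (before-last (FP.<⇒≢ σL<σq ∘ sym)) (inj₁ (σp<σL , σL<σq))
  ... | tri≈ _ refl _ = FP.<-irrefl refl (FP.<-trans σp<σL σL<σq)
  ... | tri> _ _ q<p  = records q<p (before-last (FP.<⇒≢ σp<σL)) (inj₂ (σp<σL , σL<σq))

lookup-∷ʳ-fromℕ : ∀ {A : Set} {n} (v : Vec A n) x → lookup (v ∷ʳ x) (fromℕ n) ≡ x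
lookup-∷ʳ-fromℕ []      x = refl
lookup-∷ʳ-fromℕ (_ ∷ v) x = lookup-∷ʳ-fromℕ v x

lookup-∷ʳ-inject₁ : ∀ {A : Set} {n} (v : Vec A n) x j → lookup (v ∷ʳ x) (inject₁ j) ≡ lookup v j
lookup-∷ʳ-inject₁ (_ ∷ v) x zero    = refl
lookup-∷ʳ-inject₁ (_ ∷ v) x (suc j) = lookup-∷ʳ-inject₁ v x j

punchIn-fromℕ : ∀ {n} (j : Fin n) → punchIn (fromℕ n) j ≡ inject₁ j
punchIn-fromℕ zero    = refl
punchIn-fromℕ (suc j) = cong suc (punchIn-fromℕ j)

punchIn-increasing : ∀ {n} (x : Fin (suc n)) → StrictlyIncreasing (punchIn x)
punchIn-increasing x {a} {b} a<b =
  FP.≤∧≢⇒< (FP.punchIn-mono-≤ x a b (<⇒≤ a<b)) (FP.<⇒≢ a<b ∘ FP.punchIn-injective x a b)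

inject₁-increasing : ∀ {n} → StrictlyIncreasing (inject₁ {n})
inject₁-increasing {x = i} {j} i<j = subst₂ _<_ (sym (FP.toℕ-inject₁ i)) (sym (FP.toℕ-inject₁ j)) i<j

below-inject₁ : ∀ {n} {i : Fin (suc n)} {k : Fin n} → i F.< inject₁ k → ∃ λ i′ → i ≡ inject₁ i′
below-inject₁ {i = i} {k} i<k with view i
... | ‵fromℕ     = contradiction (FP.≤fromℕ (inject₁ k)) (<⇒≱ i<k)
... | ‵inject₁ j = j , refl

∀-last : ∀ {n} {P : Fin (suc n) → Set} → P (fromℕ n) → (∀ j → P (inject₁ j)) → ∀ i → P i
∀-last P-last P-inject₁ i with view i
... | ‵fromℕ     = P-last
... | ‵inject₁ j = P-inject₁ j

record LastInsertion {n} (x : Fin (suc n)) (σ′ : Fin n → Fin n) (σ : Fin (suc n) → Fin (suc n)) : Set where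
  constructor lastInsertion
  field
    last-value     : σ (fromℕ n) ≡ x
    inject₁-values : ∀ j → σ (inject₁ j) ≡ punchIn x (σ′ j)

insertLast : ∀ {n} → Fin (suc n) → (Fin n → Fin n) → Fin (suc n) → Fin (suc n)
insertLast x σ′ = lookup (tabulate (punchIn x ∘ σ′) ∷ʳ x)

insertLast-lastInsertion : ∀ {n} (x : Fin (suc n)) σ′ → LastInsertion x σ′ (insertLast x σ′)
insertLast-lastInsertion x σ′ = lastInsertion (lookup-∷ʳ-fromℕ (tabulate (punchIn x ∘ σ′)) x) λ j →
  trans (lookup-∷ʳ-inject₁ (tabulate (punchIn x ∘ σ′)) x j) (lookup∘tabulate (punchIn x ∘ σ′) j)

removeLast : ∀ {n} {σ : Fin (suc n) → Fin (suc n)} → Injective _≡_ _≡_ σ → Fin n → Fin n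
removeLast {σ = σ} σ-inj j = punchOut {i = σ (fromℕ _)} {j = σ (inject₁ j)} (FP.fromℕ≢inject₁ ∘ σ-inj)

removeLast-lastInsertion : ∀ {n x} {σ : Fin (suc n) → Fin (suc n)} (σ-inj : Injective _≡_ _≡_ σ) →
                           σ (fromℕ n) ≡ x → LastInsertion x (removeLast σ-inj) σ
removeLast-lastInsertion σ-inj refl = lastInsertion refl λ j → sym (FP.punchIn-punchOut _)

removeLast-injective : ∀ {n} {σ : Fin (suc n) → Fin (suc n)} (σ-inj : Injective _≡_ _≡_ σ) →
                       Injective _≡_ _≡_ (removeLast σ-inj)
removeLast-injective {σ = σ} σ-inj = FP.inject₁-injective ∘ σ-inj ∘ FP.punchOut-injective (last≢ _) (last≢ _)
  where
  last≢ : ∀ j → σ (fromℕ _) ≢ σ (inject₁ j)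
  last≢ _ = FP.fromℕ≢inject₁ ∘ σ-inj

lastInsertion-injective : ∀ {n x σ′} {σ : Fin (suc n) → Fin (suc n)} → LastInsertion x σ′ σ →
                          Injective _≡_ _≡_ σ′ → Injective _≡_ _≡_ σ
lastInsertion-injective {x = x} {σ′} (lastInsertion σL≡x σ∘inject₁≡) σ′-inj {i} {j} σi≡σj
  with view i | view j
... | ‵fromℕ      | ‵fromℕ      = refl
... | ‵fromℕ      | ‵inject₁ j′ =
  contradiction (trans (sym (σ∘inject₁≡ j′)) (trans (sym σi≡σj) σL≡x)) (FP.punchInᵢ≢i x (σ′ j′))
... | ‵inject₁ i′ | ‵fromℕ      =
  contradiction (trans (sym (σ∘inject₁≡ i′)) (trans σi≡σj σL≡x)) (FP.punchInᵢ≢i x (σ′ i′))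
... | ‵inject₁ i′ | ‵inject₁ j′ = cong inject₁ (σ′-inj (FP.punchIn-injective x _ _
  (trans (sym (σ∘inject₁≡ i′)) (trans σi≡σj (σ∘inject₁≡ j′)))))

lastInsertion-allRecords⁻ : ∀ {n x σ′} {σ : Fin (suc n) → Fin (suc n)} → LastInsertion x σ′ σ →
                            AllRecords σ → AllRecords σ′
lastInsertion-allRecords⁻ {x = x} {σ = σ} (lastInsertion _ σ∘inject₁≡) records {i} {j} {k} i<j j<k between =
  records (inject₁-increasing i<j) (inject₁-increasing j<k) between′
  where
  between′ : Between (σ (inject₁ i)) (σ (inject₁ j)) (σ (inject₁ k))
  between′ rewrite σ∘inject₁≡ i | σ∘inject₁≡ j | σ∘inject₁≡ k =
    Between-map (punchIn-increasing x) between

lastInsertion-allRecords⁺ : ∀ {n x σ′} {σ : Fin (suc n) → Fin (suc n)} → LastInsertion x σ′ σ →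
                            Extreme x → AllRecords σ′ → AllRecords σ
lastInsertion-allRecords⁺ {x = x} {σ′} (lastInsertion σL≡x σ∘inject₁≡) x-extreme records
                          {i} {j} {k} i<j j<k between with view k
... | ‵fromℕ = extreme⇒¬Between x-extreme (subst (Between _ _) σL≡x between)
... | ‵inject₁ k′ with below-inject₁ j<k | below-inject₁ (FP.<-trans i<j j<k)
...   | j′ , refl | i′ , refl =
  records (increasing⇒reflects-< inject₁-increasing i<j) (increasing⇒reflects-< inject₁-increasing j<k)
          (Between-unmap (punchIn-increasing x) between′)
  where
  between′ : Between (punchIn x (σ′ i′)) (punchIn x (σ′ j′)) (punchIn x (σ′ k′))
  between′ rewrite sym (σ∘inject₁≡ i′) | sym (σ∘inject₁≡ j′) | sym (σ∘inject₁≡ k′) = between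

IsW : ∀ {n} → (Fin n → Fin n) → Set
IsW σ = Injective _≡_ _≡_ σ × AllRecords σ

insertLast-isW : ∀ {n} {x : Fin (suc n)} {σ′} → Extreme x → IsW σ′ → IsW (insertLast x σ′)
insertLast-isW {x = x} {σ′} x-extreme (σ′-inj , records) =
  lastInsertion-injective (insertLast-lastInsertion x σ′) σ′-inj ,
  lastInsertion-allRecords⁺ (insertLast-lastInsertion x σ′) x-extreme records

removeLast-isW : ∀ {n} {σ : Fin (suc n) → Fin (suc n)} ((σ-inj , _) : IsW σ) → IsW (removeLast σ-inj)
removeLast-isW (σ-inj , records) =
  removeLast-injective σ-inj , lastInsertion-allRecords⁻ (removeLast-lastInsertion σ-inj refl) records

-- Boxes and staircases

+-cancelˡ-≤⇔ : ∀ x {y z} → (x + y ≤ x + z) ⇔ (y ≤ z)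
+-cancelˡ-≤⇔ x = mk⇔ (+-cancelˡ-≤ x _ _) (+-monoʳ-≤ x)

level-shift : ∀ m b K → suc m * b + K ≡ m * b + (K + b)
level-shift = solve-∀

module _ (b : ℕ) where

  Box : ∀ m → ℕ → (Fin (suc m) → Fin (suc m)) → (Fin (suc m) → ℕ) → Set
  Box m K σ e = ∀ i → toℕ (σ i) * b + e i ≤ m * b + K

  -- The left summand is the union of the boxes of the σ ∈ W ending with their maximum,
  -- the right one that of the σ ending with their minimum.
  Staircase : ∀ m → ℕ → (Fin (suc m) → ℕ) → Set
  Staircase zero    K e = e zero ≤ K
  Staircase (suc m) K e = (e (fromℕ (suc m)) ≤ K × Staircase m (K + b) (e ∘ inject₁))
                        ⊎ (e (fromℕ (suc m)) ≤ suc m * b + K × Staircase m K (e ∘ inject₁))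

  staircase? : ∀ m K e → Dec (Staircase m K e)
  staircase? zero    K e = e zero ≤? K
  staircase? (suc m) K e = (_ ≤? K ×-dec staircase? m (K + b) _) ⊎-dec (_ ≤? _ ×-dec staircase? m K _)

  staircase-resp-≗ : ∀ m {K e e′} → (∀ i → e i ≡ e′ i) → Staircase m K e → Staircase m K e′
  staircase-resp-≗ zero    e≗e′ = subst (_≤ _) (e≗e′ zero)
  staircase-resp-≗ (suc m) e≗e′ =
    Sum.map (Product.map (subst (_≤ _) (e≗e′ _)) (staircase-resp-≗ m (e≗e′ ∘ inject₁)))
            (Product.map (subst (_≤ _) (e≗e′ _)) (staircase-resp-≗ m (e≗e′ ∘ inject₁)))

  staircase-mono : ∀ m {K K′ e} → K ≤ K′ → Staircase m K e → Staircase m K′ e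
  staircase-mono zero    K≤K′ st = ≤-trans st K≤K′
  staircase-mono (suc m) K≤K′ =
    Sum.map (Product.map (λ eL≤K → ≤-trans eL≤K K≤K′) (staircase-mono m (+-monoˡ-≤ b K≤K′)))
            (Product.map (λ eL≤ → ≤-trans eL≤ (+-monoʳ-≤ (suc m * b) K≤K′)) (staircase-mono m K≤K′))

  box-max⇔ : ∀ {m K σ σ′ e} → LastInsertion (fromℕ (suc m)) σ′ σ →
             Box (suc m) K σ e ⇔ (e (fromℕ (suc m)) ≤ K × Box m (K + b) σ′ (e ∘ inject₁))
  box-max⇔ {m} {K} {σ} {σ′} {e} (lastInsertion σL≡max σ∘inject₁≡) = mk⇔
    (λ box → to at-last (box _) , λ j → to (at-inject₁ j) (box (inject₁ j)))
    (λ (eL≤K , box′) → ∀-last (from at-last eL≤K) (λ j → from (at-inject₁ j) (box′ j)))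
    where
    at-last : (toℕ (σ (fromℕ (suc m))) * b + e (fromℕ (suc m)) ≤ suc m * b + K) ⇔ (e (fromℕ (suc m)) ≤ K)
    at-last rewrite σL≡max | FP.toℕ-fromℕ m = +-cancelˡ-≤⇔ (suc m * b)
    at-inject₁ : ∀ j → (toℕ (σ (inject₁ j)) * b + e (inject₁ j) ≤ suc m * b + K)
                     ⇔ (toℕ (σ′ j) * b + e (inject₁ j) ≤ m * b + (K + b))
    at-inject₁ j rewrite σ∘inject₁≡ j | punchIn-fromℕ (σ′ j) | FP.toℕ-inject₁ (σ′ j) | level-shift m b K =
      ⇔-refl

  box-min⇔ : ∀ {m K σ σ′ e} → LastInsertion zero σ′ σ →
             Box (suc m) K σ e ⇔ (e (fromℕ (suc m)) ≤ suc m * b + K × Box m K σ′ (e ∘ inject₁))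
  box-min⇔ {m} {K} {σ} {σ′} {e} (lastInsertion σL≡0 σ∘inject₁≡) = mk⇔
    (λ box → to at-last (box _) , λ j → to (at-inject₁ j) (box (inject₁ j)))
    (λ (eL≤ , box′) → ∀-last (from at-last eL≤) (λ j → from (at-inject₁ j) (box′ j)))
    where
    at-last : (toℕ (σ (fromℕ (suc m))) * b + e (fromℕ (suc m)) ≤ suc m * b + K)
            ⇔ (e (fromℕ (suc m)) ≤ suc m * b + K)
    at-last rewrite σL≡0 = ⇔-refl
    at-inject₁ : ∀ j → (toℕ (σ (inject₁ j)) * b + e (inject₁ j) ≤ suc m * b + K)
                     ⇔ (toℕ (σ′ j) * b + e (inject₁ j) ≤ m * b + K)
    at-inject₁ j rewrite σ∘inject₁≡ j | +-assoc b (toℕ (σ′ j) * b) (e (inject₁ j)) | +-assoc b (m * b) K =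
      +-cancelˡ-≤⇔ b

  staircase⇒box : ∀ m {K e} → Staircase m K e → ∃ λ σ → IsW σ × Box m K σ e
  staircase⇒box zero st = id , (id , allRecords-Fin1) , λ { zero → st }
  staircase⇒box (suc m) (inj₁ (eL≤K , st)) with σ′ , w′ , box′ ← staircase⇒box m st =
    insertLast (fromℕ (suc m)) σ′ , insertLast-isW (inj₂ refl) w′ ,
    from (box-max⇔ (insertLast-lastInsertion _ σ′)) (eL≤K , box′)
  staircase⇒box (suc m) (inj₂ (eL≤ , st)) with σ′ , w′ , box′ ← staircase⇒box m st =
    insertLast zero σ′ , insertLast-isW (inj₁ refl) w′ ,
    from (box-min⇔ (insertLast-lastInsertion _ σ′)) (eL≤ , box′)

  box⇒staircase : ∀ m {K e σ} → IsW σ → Box m K σ e → Staircase m K e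
  box⇒staircase zero    _ box = ≤-trans (m≤n+m _ _) (box zero)
  box⇒staircase (suc m) w@(σ-inj , records) box with last-extreme σ-inj records
  ... | inj₂ σL≡max = inj₁ (Product.map₂ (box⇒staircase m (removeLast-isW w))
                                         (to (box-max⇔ (removeLast-lastInsertion σ-inj σL≡max)) box))
  ... | inj₁ σL≡0   = inj₂ (Product.map₂ (box⇒staircase m (removeLast-isW w))
                                         (to (box-min⇔ (removeLast-lastInsertion σ-inj σL≡0)) box))

-- The Alexander dual

-- The exponent (a ∖ b)_i for a_i = u₁ + M + K (with u₁ = suc u, c = suc K) and b_i = u₁ + y.
dualExponent≡ : ∀ u M K y → (suc u + M + suc K ∸ 1) + 1 ∸ suc (u + y) ≡ suc (M + K) ∸ y
dualExponent≡ u M K y = begin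
  (suc u + M + suc K ∸ 1) + 1 ∸ suc (u + y) ≡⟨ cong (λ A → A ∸ 1 + 1 ∸ suc (u + y)) (+-suc (suc u + M) K) ⟩
  u + M + K + 1 ∸ (u + y)                   ≡⟨ cong (_∸ (u + y)) (regroup u M K) ⟩
  u + suc (M + K) ∸ (u + y)                 ≡⟨ [m+n]∸[m+o]≡n∸o u (suc (M + K)) y ⟩
  suc (M + K) ∸ y                           ∎
  where
  open ≡-Reasoning
  regroup : ∀ u M K → u + M + K + 1 ≡ u + suc (M + K)
  regroup = solve-∀

dualExponent≤⇔ : ∀ N y x → (suc N ∸ y ≤ x) ⇔ (¬ (y + x ≤ N))
dualExponent≤⇔ N y x = mk⇔
  (λ d≤x y+x≤N → 1+n≰n (begin
     suc N          ≡⟨ sym (m∸n+n≡m (≤-trans (m≤m+n y x) (m≤n⇒m≤1+n y+x≤N))) ⟩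
     suc N ∸ y + y  ≤⟨ +-monoˡ-≤ y d≤x ⟩
     x + y          ≡⟨ +-comm x y ⟩
     y + x          ≤⟨ y+x≤N ⟩
     N              ∎))
  (λ y+x≰N → m≤n+o⇒m∸n≤o (suc N) y (≰⇒> y+x≰N))
  where open ≤-Reasoning

lookup-diffExp : ∀ {n} (a g : Mono n) i {y} → lookup g i ≡ suc y →
                 lookup (diffExp a g) i ≡ lookup a i + 1 ∸ suc y
lookup-diffExp (_ ∷ _) (_ ∷ _) zero    refl  = refl
lookup-diffExp (_ ∷ a) (_ ∷ g) (suc i) g[i]≡ = lookup-diffExp a g i g[i]≡

-- Parameters: u₁ = suc u, m + 1 variables and c = suc K.
module AlexanderDual (u b m K : ℕ) .{{_ : NonZero b}} where

  𝐮 : Fin (suc m) → ℕ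
  𝐮 = uVec (suc u) b (suc m)

  G : Gens (suc m)
  G = GenW (suc m) 𝐮

  a : Mono (suc m)
  a = replicate (suc m) (uLast (suc u) b (suc m) + suc K ∸ 1)

  generator : (Fin (suc m) → Fin (suc m)) → Mono (suc m)
  generator σ = tabulate (𝐮 ∘ σ)

  generator-minGen : ((σ , σ-inj) : Perm (suc m)) → InW (suc m) (σ , σ-inj) → MinGen G (generator σ)
  generator-minGen (σ , σ-inj) σ∈W = ((σ , σ-inj) , σ∈W , refl) , minimal
    where
    minimal : ∀ g → G g → g ∣ᵐ generator σ → g ≡ generator σ
    minimal _ ((τ , τ-inj) , _ , refl) τ∣σ = tabulate-cong (cong 𝐮 ∘ injective-≤⇒≡ σ-inj τ-inj τ≤σ)
      where
      τ≤σ : ∀ i → τ i F.≤ σ i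
      τ≤σ i = *-cancelʳ-≤ _ _ b (+-cancelˡ-≤ (suc u) _ _
                (subst₂ _≤_ (lookup∘tabulate (𝐮 ∘ τ) i) (lookup∘tabulate (𝐮 ∘ σ) i) (τ∣σ i)))

  lookup-diffExp-generator : ∀ σ i → lookup (diffExp a (generator σ)) i ≡ suc (m * b + K) ∸ toℕ (σ i) * b
  lookup-diffExp-generator σ i =
    trans (lookup-diffExp a (generator σ) i (lookup∘tabulate (𝐮 ∘ σ) i))
          (trans (cong (λ A → A + 1 ∸ suc (u + toℕ (σ i) * b)) (lookup-replicate i _))
                 (dualExponent≡ u (m * b) K (toℕ (σ i) * b)))

  inMPow-at⇔ : ∀ σ e i → let dᵢ = lookup (diffExp a (generator σ)) i in
               (1 ≤ dᵢ × dᵢ ≤ lookup e i) ⇔ (¬ (toℕ (σ i) * b + lookup e i ≤ m * b + K))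
  inMPow-at⇔ σ e i rewrite lookup-diffExp-generator σ i = mk⇔
    (to (dualExponent≤⇔ _ _ _) ∘ Product.proj₂)
    (λ outside → m<n⇒0<n∸m (s≤s (m≤n⇒m≤n+o K (*-monoˡ-≤ b (FP.toℕ≤pred[n] (σ i))))) ,
                 from (dualExponent≤⇔ _ _ _) outside)

  inMPow⇔¬box : ∀ σ e → InMPow (diffExp a (generator σ)) e ⇔ (¬ Box b m K σ (lookup e))
  inMPow⇔¬box σ e = mk⇔
    (λ (i , eᵢ-large) box → to (inMPow-at⇔ σ e i) eᵢ-large (box i))
    (λ ¬box → Product.map₂ (from (inMPow-at⇔ σ e _)) (FP.¬∀⟶∃¬ (suc m) _ (λ i → _ ≤? _) ¬box))

  ¬inAlexDual⇔staircase : ∀ e → (¬ InAlexDual a G e) ⇔ Staircase b m K (lookup e)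
  ¬inAlexDual⇔staircase e = mk⇔ outside⇒staircase staircase⇒outside
    where
    staircase⇒outside : Staircase b m K (lookup e) → ¬ InAlexDual a G e
    staircase⇒outside st dual with σ , (σ-inj , records) , box ← staircase⇒box b m st =
      to (inMPow⇔¬box σ e) (dual (generator σ) (generator-minGen (σ , σ-inj) (allRecords⇒avoids records))) box
    -- Staircase is decidable, so it suffices to refute ¬ Staircase.
    outside⇒staircase : ¬ InAlexDual a G e → Staircase b m K (lookup e)
    outside⇒staircase outside with staircase? b m K (lookup e)
    ... | yes st = st
    ... | no ¬st = contradiction dual outside
      where
      dual : InAlexDual a G e
      dual _ (((σ , σ-inj) , (¬132 , ¬312) , refl) , _) =
        from (inMPow⇔¬box σ e) (¬st ∘ box⇒staircase b m (σ-inj , avoids⇒allRecords ¬132 ¬312))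

-- Counting standard monomials

Enumerates : ∀ {A : Set} → (A → Set) → List A → Set
Enumerates P xs = Unique xs × (∀ x → x ∈ xs ⇔ P x)

enumerates-cong : ∀ {A : Set} {P Q : A → Set} {xs} → (∀ x → P x ⇔ Q x) → Enumerates P xs → Enumerates Q xs
enumerates-cong P⇔Q (xs-unique , xs-complete) = xs-unique , λ x → ⇔-trans (xs-complete x) (P⇔Q x)

enumerates-length : ∀ {A : Set} {P : A → Set} {xs ys} → Enumerates P xs → Enumerates P ys →
                    length xs ≡ length ys
enumerates-length (xs-unique , xs-complete) (ys-unique , ys-complete) = ↭-length (∼bag⇒↭
  (unique∧set⇒bag xs-unique ys-unique λ {x} → ⇔-trans (xs-complete x) (⇔-sym (ys-complete x))))

enumerates-++ : ∀ {A : Set} {P Q : A → Set} {xs ys} → Enumerates P xs → Enumerates Q ys →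
                (∀ {x} → P x → ¬ Q x) → Enumerates (λ x → P x ⊎ Q x) (xs ++ ys)
enumerates-++ {xs = xs} (xs-unique , xs-complete) (ys-unique , ys-complete) P∩Q=∅ =
  Unique.++⁺ xs-unique ys-unique
    (λ (x∈xs , x∈ys) → P∩Q=∅ (to (xs-complete _) x∈xs) (to (ys-complete _) x∈ys)) ,
  λ x → ⇔-trans (++-∈⇔ {xs = xs}) (xs-complete x ⊎-⇔ ys-complete x)

enumerates-cartesianProductWith : ∀ {A B C : Set} {R : A → Set} {P : B → Set} {xs ys} (f : A → B → C) →
  (∀ {a a′ b b′} → f a b ≡ f a′ b′ → a ≡ a′ × b ≡ b′) → Enumerates R xs → Enumerates P ys →
  Enumerates (λ c → ∃₂ λ a b → R a × P b × c ≡ f a b) (cartesianProductWith f xs ys)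
enumerates-cartesianProductWith {xs = xs} {ys} f f-injective (xs-unique , xs-complete) (ys-unique , ys-complete) =
  Unique.cartesianProductWith⁺ f f-injective xs-unique ys-unique , λ c → mk⇔
    (λ c∈ → let a , b , a∈ , b∈ , c≡ = ∈-cartesianProductWith⁻ f xs ys c∈ in
       a , b , to (xs-complete a) a∈ , to (ys-complete b) b∈ , c≡)
    (λ (a , b , Ra , Pb , c≡) → subst (_∈ _) (sym c≡)
       (∈-cartesianProductWith⁺ f (from (xs-complete a) Ra) (from (ys-complete b) Pb)))

length-cartesianProductWith : ∀ {A B C : Set} (f : A → B → C) xs ys →
                              length (cartesianProductWith f xs ys) ≡ length xs * length ys
length-cartesianProductWith f []       ys = refl
length-cartesianProductWith f (x ∷ xs) ys = begin
  length (List.map (f x) ys ++ cartesianProductWith f xs ys)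
    ≡⟨ length-++ (List.map (f x) ys) ⟩
  length (List.map (f x) ys) + length (cartesianProductWith f xs ys)
    ≡⟨ cong₂ _+_ (length-map (f x) ys) (length-cartesianProductWith f xs ys) ⟩
  length ys + length xs * length ys
    ∎
  where open ≡-Reasoning

enumerates-upTo : ∀ K → Enumerates (_≤ K) (upTo (suc K))
enumerates-upTo K = Unique.upTo⁺ (suc K) , λ x → mk⇔ (s≤s⁻¹ ∘ ∈-upTo⁻) (∈-upTo⁺ ∘ s≤s)

interval : ℕ → ℕ → List ℕ
interval K t = applyUpTo (λ i → suc (i + K)) t

enumerates-interval : ∀ K t → Enumerates (λ x → K < x × x ≤ t + K) (interval K t)
enumerates-interval K t =
  Unique.applyUpTo⁺₁ _ t (λ i<j _ → <⇒≢ (s≤s (+-monoˡ-< K i<j))) , λ x → mk⇔ member member⁻¹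
  where
  member : ∀ {x} → x ∈ interval K t → K < x × x ≤ t + K
  member x∈ with i , i<t , refl ← ∈-applyUpTo⁻ (λ i → suc (i + K)) x∈ = s≤s (m≤n+m K i) , +-monoˡ-≤ K i<t
  member⁻¹ : ∀ {x} → K < x × x ≤ t + K → x ∈ interval K t
  member⁻¹ {suc x} (s≤s K≤x , x<t+K) with x ∸ K | m∸n+n≡m K≤x
  ... | i | refl = ∈-applyUpTo⁺ (λ i → suc (i + K)) (+-cancelʳ-≤ K (suc i) t x<t+K)

snocAll : ∀ {n} → List ℕ → List (Vec ℕ n) → List (Vec ℕ (suc n))
snocAll = cartesianProductWith (flip _∷ʳ_)

enumerates-snocAll : ∀ {n} {R : ℕ → Set} {P : Vec ℕ n → Set} {xs L} → Enumerates R xs → Enumerates P L →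
                     Enumerates (λ w → ∃₂ λ x v → R x × P v × w ≡ v ∷ʳ x) (snocAll xs L)
enumerates-snocAll = enumerates-cartesianProductWith (flip _∷ʳ_) λ eq → Product.swap (∷ʳ-injective _ _ eq)

module _ (b : ℕ) where

  LargeLast SmallLast : ∀ m → ℕ → Vec ℕ (suc (suc m)) → Set
  LargeLast m K w = ∃₂ λ x v → (K < x × x ≤ suc m * b + K) × Staircase b m K (lookup v) × w ≡ v ∷ʳ x
  SmallLast m K w = ∃₂ λ x v → x ≤ K × Staircase b m (K + b) (lookup v) × w ≡ v ∷ʳ x

  staircase-∷ʳ-init : ∀ m {K} (v : Vec ℕ (suc m)) x →
                      Staircase b m K (lookup (v ∷ʳ x) ∘ inject₁) ⇔ Staircase b m K (lookup v)
  staircase-∷ʳ-init m v x =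
    mk⇔ (staircase-resp-≗ b m (lookup-∷ʳ-inject₁ v x)) (staircase-resp-≗ b m (sym ∘ lookup-∷ʳ-inject₁ v x))

  staircase-∷ʳ⁺ : ∀ m K {w} → LargeLast m K w ⊎ SmallLast m K w → Staircase b (suc m) K (lookup w)
  staircase-∷ʳ⁺ m K (inj₁ (x , v , (_ , x≤) , st , refl)) =
    inj₂ (subst (_≤ _) (sym (lookup-∷ʳ-fromℕ v x)) x≤ , from (staircase-∷ʳ-init m v x) st)
  staircase-∷ʳ⁺ m K (inj₂ (x , v , x≤K , st , refl)) =
    inj₁ (subst (_≤ _) (sym (lookup-∷ʳ-fromℕ v x)) x≤K , from (staircase-∷ʳ-init m v x) st)

  staircase-∷ʳ⁻ : ∀ m K {w} → Staircase b (suc m) K (lookup w) → LargeLast m K w ⊎ SmallLast m K w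
  staircase-∷ʳ⁻ m K {w} st with initLast w
  ... | v , x , refl with x ≤? K | st
  ...   | yes x≤K | inj₁ (_ , st′) = inj₂ (x , v , x≤K , to (staircase-∷ʳ-init m v x) st′ , refl)
  ...   | yes x≤K | inj₂ (_ , st′) =
    inj₂ (x , v , x≤K , staircase-mono b m (m≤m+n K b) (to (staircase-∷ʳ-init m v x) st′) , refl)
  ...   | no  x≰K | inj₁ (x≤K , _) = contradiction (subst (_≤ K) (lookup-∷ʳ-fromℕ v x) x≤K) x≰K
  ...   | no  x≰K | inj₂ (x≤ , st′) = inj₁
    (x , v , (≰⇒> x≰K , subst (_≤ _) (lookup-∷ʳ-fromℕ v x) x≤) , to (staircase-∷ʳ-init m v x) st′ , refl)

  staircase-suc-enumeration : ∀ m K {L₁ L₂} →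
    Enumerates (Staircase b m K ∘ lookup) L₁ → Enumerates (Staircase b m (K + b) ∘ lookup) L₂ →
    Enumerates (Staircase b (suc m) K ∘ lookup) (snocAll (interval K (suc m * b)) L₁ ++ snocAll (upTo (suc K)) L₂)
  staircase-suc-enumeration m K E₁ E₂ =
    enumerates-cong (λ _ → mk⇔ (staircase-∷ʳ⁺ m K) (staircase-∷ʳ⁻ m K))
      (enumerates-++ (enumerates-snocAll (enumerates-interval K (suc m * b)) E₁)
                     (enumerates-snocAll (enumerates-upTo K) E₂)
                     large∩small=∅)
    where
    large∩small=∅ : ∀ {w} → LargeLast m K w → ¬ SmallLast m K w
    large∩small=∅ (x , v , (K<x , _) , _ , refl) (x′ , v′ , x′≤K , _ , eq) =
      <⇒≱ K<x (subst (_≤ K) (sym (∷ʳ-injectiveʳ v v′ eq)) x′≤K)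

ATilde⇒enumerates : ∀ u b m K {d} .{{_ : NonZero b}} → ATilde (suc u) b (suc m) (suc K) d →
                    ∃ λ L → Enumerates (Staircase b m K ∘ lookup) L × length L ≡ d
ATilde⇒enumerates u b m K (L , L-unique , L-complete , L-length) =
  L , (L-unique , λ e → ⇔-trans (L-complete e) (AlexanderDual.¬inAlexDual⇔staircase u b m K e)) , L-length

ATilde-recurrence : ∀ u b m K {d d₁ d₂} .{{_ : NonZero b}} →
  ATilde (suc u) b (suc (suc m)) (suc K) d → ATilde (suc u) b (suc m) (suc K) d₁ →
  ATilde (suc u) b (suc m) (suc (K + b)) d₂ → d ≡ suc m * b * d₁ + suc K * d₂
ATilde-recurrence u b m K ã ã₁ ã₂
  with L , E , refl ← ATilde⇒enumerates u b (suc m) K ã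
     | L₁ , E₁ , refl ← ATilde⇒enumerates u b m K ã₁
     | L₂ , E₂ , refl ← ATilde⇒enumerates u b m (K + b) ã₂ = begin
  length L
    ≡⟨ enumerates-length E (staircase-suc-enumeration b m K E₁ E₂) ⟩
  length (snocAll large L₁ ++ snocAll small L₂)
    ≡⟨ length-++ (snocAll large L₁) ⟩
  length (snocAll large L₁) + length (snocAll small L₂)
    ≡⟨ cong₂ _+_ (length-cartesianProductWith (flip _∷ʳ_) large L₁)
                 (length-cartesianProductWith (flip _∷ʳ_) small L₂) ⟩
  length large * length L₁ + length small * length L₂
    ≡⟨ cong₂ (λ s t → s * length L₁ + t * length L₂) (length-applyUpTo _ (suc m * b)) (length-upTo (suc K)) ⟩
  suc m * b * length L₁ + suc K * length L₂
    ∎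
  where
  open ≡-Reasoning
  large = interval K (suc m * b)
  small = upTo (suc K)

proposition5 : (u1 b : ℕ) → 1 ≤ u1 → 1 ≤ b → (n c : ℕ) → 3 ≤ n → 1 ≤ c →
    (d d₁ d₂ : ℕ) →
    ATilde u1 b n c d → ATilde u1 b (n ∸ 1) c d₁ → ATilde u1 b (n ∸ 1) (c + b) d₂ →
    d ≡ (n ∸ 1) * b * d₁ + c * d₂
proposition5 (suc u) b (s≤s _) 1≤b (suc (suc (suc m))) (suc K) (s≤s (s≤s (s≤s _))) (s≤s _) d d₁ d₂ =
  ATilde-recurrence u b (suc m) K {{>-nonZero 1≤b}}
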